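{- There is a (computable) reduction from Hilbert's tenth problem over the rationals — given a polynomial $P$ with rational coefficients, decide whether $P(q_1,\dots,q_n)=0$ has a rational solution — to the following problem: given a polynomial $P$, decide whether there exist rationals $q_0,q_1,\dots,q_n$ such that $q_0\cdot P\!\left(\frac{q_1}{q_0},\dots,\frac{q_n}{q_0}\right)=0$, subject to $q_0\leq q_i$ for every $i=1,\dots,n$ and $q_i\geq 1$ for every $i=0,\dots,n$.
   Context: This lemma is the first step in a chain of reductions from Hilbert's tenth problem over the rationals (whose decidability is a long-standing open problem) to the boolean analysis problem for mean-payoff expression games in which player 1 is restricted to finite-memory strategies; this chain establishes hardness of that boolean analysis problem with respect to Hilbert's tenth problem over the rationals. -}

module Defs where

open import Data.Nat using (ℕ)
open import Data.Fin using (Fin)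
open import Data.Product using (Σ; ∃; _×_; _,_)
open import Data.Rational using (ℚ; 0ℚ; 1ℚ; _+_; _*_; _÷_; _≤_; _<_; positive)

open import Data.Rational.Properties using (<-≤-trans; pos⇒nonZero)
open import Relation.Binary.PropositionalEquality using (_≡_)

-- Multivariate polynomials with rational coefficients in the variables
-- x_0 … x_{n-1}, given as polynomial expressions (every polynomial in
-- ℚ[x_0,…,x_{n-1}] is denoted by such an expression, and conversely).
data Poly (n : ℕ) : Set where
  con : ℚ → Poly n
  var : Fin n → Poly n
  _⊕_ : Poly n → Poly n → Poly n
  _⊗_ : Poly n → Poly n → Poly n

eval : ∀ {n} → Poly n → (Fin n → ℚ) → ℚ
eval (con c) q = c
eval (var i) q = q i
eval (P ⊕ Q) q = eval P q + eval Q q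
eval (P ⊗ Q) q = eval P q * eval Q q

Instance : Set
Instance = Σ ℕ Poly

H10ℚ : Instance → Set
H10ℚ (n , P) = ∃ λ (q : Fin n → ℚ) → eval P q ≡ 0ℚ

0<1 : 0ℚ < 1ℚ
0<1 = Data.Rational._<_.*<* (Data.Integer.+<+ (Data.Nat.s≤s Data.Nat.z≤n))
  where import Data.Rational ; import Data.Integer ; import Data.Nat

divBy : (q₀ : ℚ) → 1ℚ ≤ q₀ → ℚ → ℚ
divBy q₀ h p = _÷_ p q₀ {{pos⇒nonZero q₀ {{positive (<-≤-trans 0<1 h)}}}}

HomogBounded : Instance → Set
HomogBounded (n , P) =
  Σ ℚ λ q₀ → Σ (Fin n → ℚ) λ q → Σ (1ℚ ≤ q₀) λ h →
    ((i : Fin n) → q₀ ≤ q i) ×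
    ((i : Fin n) → 1ℚ ≤ q i) ×
    (q₀ * eval P (λ i → divBy q₀ h (q i)) ≡ 0ℚ)

-- Substituting x_i ↦ y_i − z_i turns P into a polynomial in 2n variables
-- that has a zero with all coordinates ≥ 1 exactly when P has a rational
-- zero, since every rational is a difference of two rationals ≥ 1.  Such a
-- zero is an instance of the target problem with q₀ = 1; conversely, for
-- any solution of the target problem q₀ ≠ 0, so the point q/q₀ is a zero of
-- the substituted polynomial and yields a zero of P.
module Submission where

open import Defs
open import Data.Nat using (ℕ) renaming (_+_ to _+ℕ_)
open import Data.Fin using (Fin; _↑ˡ_; _↑ʳ_)
open import Data.Product using (Σ; _,_)
open import Data.Rational using (ℚ; 0ℚ; 1ℚ; _+_; _*_; _-_; -_; _≤_; 1/_; NonZero; positive)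
open import Data.Rational.Properties
open import Data.Rational.Solver using (module +-*-Solver)
open import Data.Vec.Functional using (_++_)
open import Data.Vec.Functional.Properties using (lookup-++ˡ; lookup-++ʳ)
open import Data.Vec.Functional.Relation.Unary.All.Properties using (++⁺)
open import Function.Bundles using (_⇔_; mk⇔)
open import Relation.Binary.PropositionalEquality
open import Relation.Nullary using (yes; no)

substitute : ∀ {m n} → Poly m → (Fin m → Poly n) → Poly n
substitute (con c) σ = con c
substitute (var i) σ = σ i
substitute (P ⊕ Q) σ = substitute P σ ⊕ substitute Q σ
substitute (P ⊗ Q) σ = substitute P σ ⊗ substitute Q σ

eval-substitute : ∀ {m n} (P : Poly m) (σ : Fin m → Poly n) (q : Fin n → ℚ) →
                  eval (substitute P σ) q ≡ eval P (λ i → eval (σ i) q)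
eval-substitute (con c) σ q = refl
eval-substitute (var i) σ q = refl
eval-substitute (P ⊕ Q) σ q = cong₂ _+_ (eval-substitute P σ q) (eval-substitute Q σ q)
eval-substitute (P ⊗ Q) σ q = cong₂ _*_ (eval-substitute P σ q) (eval-substitute Q σ q)

eval-cong : ∀ {n} (P : Poly n) {q r : Fin n → ℚ} → (∀ i → q i ≡ r i) → eval P q ≡ eval P r
eval-cong (con c) q≗r = refl
eval-cong (var i) q≗r = q≗r i
eval-cong (P ⊕ Q) q≗r = cong₂ _+_ (eval-cong P q≗r) (eval-cong Q q≗r)
eval-cong (P ⊗ Q) q≗r = cong₂ _*_ (eval-cong P q≗r) (eval-cong Q q≗r)

differenceOfVars : ∀ {n} → Fin n → Poly (n +ℕ n)
differenceOfVars {n} i = var (i ↑ˡ n) ⊕ (con (- 1ℚ) ⊗ var (n ↑ʳ i))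

eval-differenceOfVars : ∀ {n} (y z : Fin n → ℚ) (i : Fin n) →
                        eval (differenceOfVars i) (y ++ z) ≡ y i - z i
eval-differenceOfVars {n} y z i = begin
  (y ++ z) (i ↑ˡ n) + (- 1ℚ) * (y ++ z) (n ↑ʳ i) ≡⟨ cong₂ (λ a b → a + (- 1ℚ) * b)
                                                       (lookup-++ˡ y z i) (lookup-++ʳ y z i) ⟩
  y i + (- 1ℚ) * z i                             ≡⟨ solve 2 (λ a b → a :+ con (- 1ℚ) :* b := a :- b) refl (y i) (z i) ⟩
  y i - z i                                      ∎
  where open ≡-Reasoning; open +-*-Solver

record DifferenceOfAtLeastOnes (q : ℚ) : Set where
  field
    minuend subtrahend : ℚ
    1≤minuend          : 1ℚ ≤ minuend
    1≤subtrahend       : 1ℚ ≤ subtrahend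
    minuend-subtrahend : minuend - subtrahend ≡ q

open DifferenceOfAtLeastOnes

differenceOfAtLeastOnes : ∀ q → DifferenceOfAtLeastOnes q
differenceOfAtLeastOnes q with 0ℚ ≤? q
... | yes 0≤q = record
  { minuend = q + 1ℚ ; subtrahend = 1ℚ
  ; 1≤minuend = +-monoˡ-≤ 1ℚ 0≤q ; 1≤subtrahend = ≤-refl
  ; minuend-subtrahend = solve 1 (λ a → (a :+ con 1ℚ) :- con 1ℚ := a) refl q }
  where open +-*-Solver
... | no 0≰q = record
  { minuend = 1ℚ ; subtrahend = 1ℚ - q
  ; 1≤minuend = ≤-refl ; 1≤subtrahend = +-monoʳ-≤ 1ℚ (neg-antimono-≤ (<⇒≤ (≰⇒> 0≰q)))
  ; minuend-subtrahend = solve 1 (λ a → con 1ℚ :- (con 1ℚ :- a) := a) refl q }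
  where open +-*-Solver

*-zero-cancelˡ : ∀ p .{{_ : NonZero p}} q → p * q ≡ 0ℚ → q ≡ 0ℚ
*-zero-cancelˡ p q pq≡0 = begin
  q              ≡⟨ sym (*-identityˡ q) ⟩
  1ℚ * q         ≡⟨ cong (_* q) (sym (*-inverseˡ p)) ⟩
  (1/ p * p) * q ≡⟨ *-assoc (1/ p) p q ⟩
  1/ p * (p * q) ≡⟨ cong (1/ p *_) pq≡0 ⟩
  1/ p * 0ℚ      ≡⟨ *-zeroʳ (1/ p) ⟩
  0ℚ             ∎
  where open ≡-Reasoning

divBy-1 : (1≤1 : 1ℚ ≤ 1ℚ) (p : ℚ) → divBy 1ℚ 1≤1 p ≡ p
divBy-1 1≤1 = *-identityʳ

splitVariables : Instance → Instance
splitVariables (n , P) = n +ℕ n , substitute P differenceOfVars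

module _ (n : ℕ) (P : Poly n) where

  P′ : Poly (n +ℕ n)
  P′ = substitute P differenceOfVars

  solution⇒bounded : H10ℚ (n , P) → HomogBounded (splitVariables (n , P))
  solution⇒bounded (q , Pq≡0) = 1ℚ , r , ≤-refl , 1≤r , 1≤r , P′r≡0
    where
    d : ∀ i → DifferenceOfAtLeastOnes (q i)
    d i = differenceOfAtLeastOnes (q i)

    r : Fin (n +ℕ n) → ℚ
    r = (λ i → minuend (d i)) ++ (λ i → subtrahend (d i))

    1≤r : ∀ j → 1ℚ ≤ r j
    1≤r = ++⁺ (1ℚ ≤_) (λ i → 1≤minuend (d i)) (λ i → 1≤subtrahend (d i))

    P′r≡0 : 1ℚ * eval P′ (λ j → divBy 1ℚ ≤-refl (r j)) ≡ 0ℚ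
    P′r≡0 = begin
      1ℚ * eval P′ (λ j → divBy 1ℚ ≤-refl (r j)) ≡⟨ *-identityˡ _ ⟩
      eval P′ (λ j → divBy 1ℚ ≤-refl (r j))      ≡⟨ eval-cong P′ (λ j → divBy-1 ≤-refl (r j)) ⟩
      eval P′ r                                   ≡⟨ eval-substitute P differenceOfVars r ⟩
      eval P (λ i → eval (differenceOfVars i) r)  ≡⟨ eval-cong P (λ i → trans (eval-differenceOfVars _ _ i)
                                                                              (minuend-subtrahend (d i))) ⟩
      eval P q                                    ≡⟨ Pq≡0 ⟩
      0ℚ                                          ∎
      where open ≡-Reasoning

  bounded⇒solution : HomogBounded (splitVariables (n , P)) → H10ℚ (n , P)
  bounded⇒solution (q₀ , q , 1≤q₀ , _ , _ , q₀Pr≡0) =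
    (λ i → eval (differenceOfVars i) r) ,
    trans (sym (eval-substitute P differenceOfVars r))
          (*-zero-cancelˡ q₀ {{pos⇒nonZero q₀ {{positive (<-≤-trans 0<1 1≤q₀)}}}} _ q₀Pr≡0)
    where
    r : Fin (n +ℕ n) → ℚ
    r j = divBy q₀ 1≤q₀ (q j)

lemma10 : Σ (Instance → Instance) λ f →
    (x : Instance) → H10ℚ x ⇔ HomogBounded (f x)
lemma10 = splitVariables , λ (n , P) → mk⇔ (solution⇒bounded n P) (bounded⇒solution n P)
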